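{- Let $c\geq 2$, $\mathcal{C}=\{1,2c\}$, $p\geq 4$, and let $n$ be a positive integer such that $\mathcal{G}_{\mathcal{C}}(m)=s_c(m)$ for all $1\le m\le n$. Then for every exiting partition $O$ of $n$ into $p$ parts there is a partition $O'$ of $n$ into $p$ parts that is not exiting and satisfies $\mathcal{G}(O')=\mathcal{G}(O)$.
   Context: $\mathcal{G}_{\mathcal{C}}$ is the nim-sequence of \textsc{cut} with cut-set $\mathcal{C}$: $\mathcal{G}_{\mathcal{C}}(n)=\operatorname{mex}\{\mathcal{G}_{\mathcal{C}}(h_0)\oplus\cdots\oplus\mathcal{G}_{\mathcal{C}}(h_d): d\in\mathcal{C}, h_i\geq 1, \sum h_i=n\}$, with $\oplus$ bitwise XOR. A partition of $n$ into $p$ parts is a tuple $(h_1,\dots,h_p)$ of positive integers summing to $n$, with nim-value $\mathcal{G}_{\mathcal{C}}(h_1)\oplus\cdots\oplus\mathcal{G}_{\mathcal{C}}(h_p)$. The sequence $s_c$: for $n=12cq+m$, $q\ge0$, $1\le m\le 12c$, $s_c(n)=8q+t(m)$ with $t(m)=0/1$ for $1\le m\le 2c$ ($m$ odd/even), $2/3$ for $2c<m\le 4c$, $t(4c+1)=1$, $5/4$ for $4c+2\le m\le 6c$, $3/2$ for $6c<m\le 8c$, $4/5$ for $8c<m\le 10c$, $6/7$ for $10c<m\le 12c$ (odd/even respectively). An outnumber is a positive integer $\equiv 0 \pmod{2c}$ or $\equiv 4c+1 \pmod{12c}$; a partition is exiting if all its parts are outnumbers. -}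

module Defs where

open import Data.Nat using (ℕ; zero; suc; _+_; _*_; _∸_; _≤_; _<_; _≡ᵇ_; _≤ᵇ_)
open import Data.Nat.DivMod using (_/_; _%_)
open import Data.Bool using (Bool; true; false; if_then_else_; _∨_; not)
open import Data.List using (List; []; _∷_; _++_; map; concatMap; foldr; upTo; length; lookup)
open import Data.Bool.ListAction using (any)
open import Data.Vec as Vec using (Vec)
import Data.Vec.Relation.Unary.All as VAll
open import Data.Product using (_×_)
open import Data.Sum using (_⊎_)
open import Relation.Binary.PropositionalEquality using (_≡_)

-- Bitwise XOR (nim-sum) on ℕ, defined bit by bit.
-- The fuel argument is large enough (m + n + 1) to process all bits.

xorF : ℕ → ℕ → ℕ → ℕ
xorF zero    m n = 0
xorF (suc k) m n =
  (if (m % 2) ≡ᵇ (n % 2) then 0 else 1) + 2 * xorF k (m / 2) (n / 2)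

_⊕_ : ℕ → ℕ → ℕ
m ⊕ n = xorF (suc (m + n)) m n

elemᵇ : ℕ → List ℕ → Bool
elemᵇ x xs = any (λ y → x ≡ᵇ y) xs

mexFrom : ℕ → ℕ → List ℕ → ℕ
mexFrom zero    k xs = k
mexFrom (suc f) k xs = if elemᵇ k xs then mexFrom f (suc k) xs else k

-- searching length xs + 1 candidates always suffices
mex : List ℕ → ℕ
mex xs = mexFrom (suc (length xs)) 0 xs

compositions : ℕ → ℕ → List (List ℕ)
compositions zero    zero    = [] ∷ []
compositions zero    (suc _) = []
compositions (suc k) n =
  concatMap (λ i → map (suc i ∷_) (compositions k (n ∸ suc i))) (upTo n)

-- A move on a heap of size n splits it into d+1 nonempty heaps, d ∈ C:
--   G_C(n) = mex { G_C(h₀) ⊕ ⋯ ⊕ G_C(h_d) : d ∈ C, hᵢ ≥ 1, Σ hᵢ = n }.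
-- It is computed by strong recursion via the table [G(0), …, G(n-1)]
-- (G(0) is a dummy entry 0; it is never used for positive heaps since
-- every part is < n when d ≥ 1).

tableLookup : List ℕ → ℕ → ℕ
tableLookup []       _       = 0
tableLookup (x ∷ xs) zero    = x
tableLookup (x ∷ xs) (suc i) = tableLookup xs i

nimSumVia : List ℕ → List ℕ → ℕ
nimSumVia tbl hs = foldr (λ h acc → tableLookup tbl h ⊕ acc) 0 hs

options : List ℕ → List ℕ → ℕ → List ℕ
options C tbl n =
  concatMap (λ d → map (nimSumVia tbl) (compositions (suc d) n)) C

table : List ℕ → ℕ → List ℕ
table C zero    = []
table C (suc n) = table C n ++ (mex (options C (table C n) n) ∷ [])

G : List ℕ → ℕ → ℕ
G C zero    = 0
G C (suc n) = tableLookup (table C (suc (suc n))) (suc n)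

-- The sequence s_c.  For n = 12cq + m with 1 ≤ m ≤ 12c,
-- s_c(n) = 8q + t(m).

isOdd : ℕ → Bool
isOdd m = (m % 2) ≡ᵇ 1

pick : ℕ → ℕ → ℕ → ℕ
pick a b m = if isOdd m then a else b

t : ℕ → ℕ → ℕ
t c m =
  if m ≤ᵇ 2 * c then pick 0 1 m
  else if m ≤ᵇ 4 * c then pick 2 3 m
  else if m ≡ᵇ 4 * c + 1 then 1
  else if m ≤ᵇ 6 * c then pick 5 4 m
  else if m ≤ᵇ 8 * c then pick 3 2 m
  else if m ≤ᵇ 10 * c then pick 4 5 m
  else pick 6 7 m

s : (c : ℕ) → ℕ → ℕ
s zero    n = 0   -- unused (c ≥ 2 in the paper)
s (suc c') n = 8 * ((n ∸ 1) / (12 * suc c')) + t (suc c') ((n ∸ 1) % (12 * suc c') + 1)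

IsPartition : (n p : ℕ) → Vec ℕ p → Set
IsPartition n p hs = VAll.All (λ h → 1 ≤ h) hs × Vec.sum hs ≡ n

nimValue : List ℕ → {p : ℕ} → Vec ℕ p → ℕ
nimValue C hs = Vec.foldr _ (λ h acc → G C h ⊕ acc) 0 hs

Outnumber : ℕ → ℕ → Set
Outnumber zero     x = 1 ≤ x   -- unused
Outnumber (suc c') x =
  1 ≤ x × (x % (2 * suc c') ≡ 0 ⊎ x % (12 * suc c') ≡ 4 * suc c' + 1)

Exiting : ℕ → {p : ℕ} → Vec ℕ p → Set
Exiting c hs = VAll.All (Outnumber c) hs

{-# OPTIONS --safe #-}

-- Write an exiting part as a = 12c·q + (αc + β), where (α, β) is one of the seven outnumber
-- residues (2c, 4c, …, 12c and 4c + 1); for c ≥ 2 its value is s(a) = u + 8q with u depending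
-- only on the residue. Four exiting parts a₁, …, a₄ are replaced by x, x, y, z: the two copies
-- of x cancel in the nim-sum; y = σc + 1 with σ ∈ {0, 2} is not an outnumber and has value σ;
-- z = 12c·Q + (αc + β) with Q = q₁ ⊕ ⋯ ⊕ q₄ has value v + 8Q, where σ ⊕ v = u₁ ⊕ ⋯ ⊕ u₄. As
-- Q ≤ q₁ + ⋯ + q₄, the part x can absorb the remaining size. Every comparison of linear
-- expressions in c made by t is decided uniformly for c ≥ 2, so suitable (σ, α, β) need only be
-- found for each of the 7⁴ combinations of residues, which is done by computation.

module Submission where

open import Defs
open import Data.Nat using (ℕ; zero; suc; _+_; _*_; _∸_; _^_; _≤_; _<_; _≡ᵇ_; _≤ᵇ_; z≤n; s≤s; NonZero)
open import Data.Nat.Properties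
open import Data.Nat.DivMod
open import Data.Nat.Divisibility using (m∣m*n; n∣m*n; m%n≡0⇒n∣m; ∣m⇒∣m*n)
open import Data.Nat.Tactic.RingSolver using (solve-∀)
open import Data.Bool using (Bool; true; false; if_then_else_; T; _∧_)
open import Data.Bool.Properties using (T-∧; T-≡)
open import Data.Bool.ListAction using (all)
open import Data.List using (List; []; _∷_; foldr; cartesianProduct)
open import Data.List.Membership.Propositional using (_∈_)
open import Data.List.Relation.Unary.Any using (here; there)
import Data.List.Relation.Unary.All as ListAll
open import Data.List.Relation.Unary.All.Properties using (all⁺)
open import Data.Maybe using (Maybe; just; nothing; is-just; to-witness-T; _<∣>_; _>>=_)
open import Data.Maybe.Properties using (≡-dec)
open import Data.Product using (Σ; ∃₂; _×_; _,_; proj₁; proj₂)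
open import Data.Sum using (_⊎_; inj₁; inj₂)
open import Data.Unit using (tt)
open import Data.Vec using (Vec; []; _∷_)
import Data.Vec as Vec
open import Data.Vec.Relation.Unary.All as All using (All; []; _∷_)
open import Function.Bundles using (Equivalence)
open import Relation.Nullary using (¬_; contradiction)
open import Relation.Nullary.Decidable using (dec⇒maybe)
open import Relation.Binary.PropositionalEquality

-- Nim-sum

bitXor : ℕ → ℕ → ℕ
bitXor a b = if a ≡ᵇ b then 0 else 1

bitXor-comm : ∀ a b → bitXor a b ≡ bitXor b a
bitXor-comm zero    zero    = refl
bitXor-comm zero    (suc b) = refl
bitXor-comm (suc a) zero    = refl
bitXor-comm (suc a) (suc b) = bitXor-comm a b

bitXor-same : ∀ a → bitXor a a ≡ 0
bitXor-same zero    = refl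
bitXor-same (suc a) = bitXor-same a

bitXor-identityʳ : ∀ {a} → a ≤ 1 → bitXor a 0 ≡ a
bitXor-identityʳ z≤n       = refl
bitXor-identityʳ (s≤s z≤n) = refl

bitXor≤1 : ∀ a b → bitXor a b ≤ 1
bitXor≤1 a b with a ≡ᵇ b
... | true  = z≤n
... | false = s≤s z≤n

bitXor≤+ : ∀ a b → bitXor a b ≤ a + b
bitXor≤+ zero    zero    = z≤n
bitXor≤+ zero    (suc b) = s≤s z≤n
bitXor≤+ (suc a) zero    = s≤s z≤n
bitXor≤+ (suc a) (suc b) = ≤-trans (bitXor≤+ a b) (≤-trans (m≤n+m (a + b) 1) (s≤s (+-monoʳ-≤ a (n≤1+n b))))

bitXor-assoc : ∀ {a b c} → a ≤ 1 → b ≤ 1 → c ≤ 1 → bitXor (bitXor a b) c ≡ bitXor a (bitXor b c)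
bitXor-assoc z≤n       z≤n       z≤n       = refl
bitXor-assoc z≤n       z≤n       (s≤s z≤n) = refl
bitXor-assoc z≤n       (s≤s z≤n) z≤n       = refl
bitXor-assoc z≤n       (s≤s z≤n) (s≤s z≤n) = refl
bitXor-assoc (s≤s z≤n) z≤n       z≤n       = refl
bitXor-assoc (s≤s z≤n) z≤n       (s≤s z≤n) = refl
bitXor-assoc (s≤s z≤n) (s≤s z≤n) z≤n       = refl
bitXor-assoc (s≤s z≤n) (s≤s z≤n) (s≤s z≤n) = refl

m%2≤1 : ∀ m → m % 2 ≤ 1
m%2≤1 m = ≤-pred (m%n<n m 2)

m≡m%2+2*[m/2] : ∀ m → m ≡ m % 2 + 2 * (m / 2)
m≡m%2+2*[m/2] m = trans (m≡m%n+[m/n]*n m 2) (cong (m % 2 +_) (*-comm (m / 2) 2))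

[b+2r]%2≡b : ∀ {b} r → b ≤ 1 → (b + 2 * r) % 2 ≡ b
[b+2r]%2≡b {b} r b≤1 = trans (%-remove-+ʳ b (m∣m*n r)) (m<n⇒m%n≡m (s≤s b≤1))

[b+2r]/2≡r : ∀ {b} r → b ≤ 1 → (b + 2 * r) / 2 ≡ r
[b+2r]/2≡r {b} r b≤1 = begin
  (b + 2 * r) / 2     ≡⟨ +-distrib-/-∣ʳ b (m∣m*n r) ⟩
  b / 2 + 2 * r / 2   ≡⟨ cong₂ _+_ (m<n⇒m/n≡0 (s≤s b≤1)) (trans (cong (_/ 2) (*-comm 2 r)) (m*n/n≡m r 2)) ⟩
  r                   ∎
  where open ≡-Reasoning

m≤1+k⇒m/2≤k : ∀ {m k} → m ≤ suc k → m / 2 ≤ k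
m≤1+k⇒m/2≤k {zero}  _  = z≤n
m≤1+k⇒m/2≤k {suc m} le = ≤-pred (≤-trans (m/n<m (suc m) 2 (s≤s (s≤s z≤n))) le)

xorF-fuel : ∀ {K K′ m n} → m ≤ K → n ≤ K → m ≤ K′ → n ≤ K′ → xorF K m n ≡ xorF K′ m n
xorF-fuel {zero}  {zero}   _   _   _   _   = refl
xorF-fuel {zero}  {suc K′} z≤n z≤n _   _   = cong (2 *_) (xorF-fuel {zero} {K′} z≤n z≤n z≤n z≤n)
xorF-fuel {suc K} {zero}   _   _   z≤n z≤n = cong (2 *_) (xorF-fuel {K} {zero} z≤n z≤n z≤n z≤n)
xorF-fuel {suc K} {suc K′} {m} {n} m≤K n≤K m≤K′ n≤K′ = cong (λ r → bitXor (m % 2) (n % 2) + 2 * r)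
  (xorF-fuel (m≤1+k⇒m/2≤k m≤K) (m≤1+k⇒m/2≤k n≤K) (m≤1+k⇒m/2≤k m≤K′) (m≤1+k⇒m/2≤k n≤K′))

⊕-as-xorF : ∀ {K m n} → m ≤ K → n ≤ K → m ⊕ n ≡ xorF K m n
⊕-as-xorF {K} {m} {n} = xorF-fuel (≤-trans (m≤m+n m n) (n≤1+n _)) (≤-trans (m≤n+m n m) (n≤1+n _))

⊕-unfold : ∀ m n → m ⊕ n ≡ bitXor (m % 2) (n % 2) + 2 * ((m / 2) ⊕ (n / 2))
⊕-unfold m n = cong (λ r → bitXor (m % 2) (n % 2) + 2 * r)
  (sym (⊕-as-xorF (≤-trans (m/n≤m m 2) (m≤m+n m n)) (≤-trans (m/n≤m n 2) (m≤n+m n m))))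

xorF-comm : ∀ K m n → xorF K m n ≡ xorF K n m
xorF-comm zero    m n = refl
xorF-comm (suc K) m n =
  cong₂ (λ b r → b + 2 * r) (bitXor-comm (m % 2) (n % 2)) (xorF-comm K (m / 2) (n / 2))

xorF-same : ∀ K m → xorF K m m ≡ 0
xorF-same zero    m = refl
xorF-same (suc K) m rewrite xorF-same K (m / 2) | bitXor-same (m % 2) = refl

xorF-identityʳ : ∀ {K m} → m ≤ K → xorF K m 0 ≡ m
xorF-identityʳ {zero}  z≤n = refl
xorF-identityʳ {suc K} {m} m≤K = begin
  bitXor (m % 2) 0 + 2 * xorF K (m / 2) 0  ≡⟨ cong₂ (λ b r → b + 2 * r) (bitXor-identityʳ (m%2≤1 m))
                                                  (xorF-identityʳ (m≤1+k⇒m/2≤k m≤K)) ⟩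
  m % 2 + 2 * (m / 2)                      ≡⟨ m≡m%2+2*[m/2] m ⟨
  m                                        ∎
  where open ≡-Reasoning

xorF≤+ : ∀ K m n → xorF K m n ≤ m + n
xorF≤+ zero    m n = z≤n
xorF≤+ (suc K) m n = begin
  bitXor (m % 2) (n % 2) + 2 * xorF K (m / 2) (n / 2)
    ≤⟨ +-mono-≤ (bitXor≤+ (m % 2) (n % 2)) (*-monoʳ-≤ 2 (xorF≤+ K (m / 2) (n / 2))) ⟩
  (m % 2 + n % 2) + 2 * (m / 2 + n / 2)
    ≡⟨ interchange (m % 2) (n % 2) (m / 2) (n / 2) ⟩
  (m % 2 + 2 * (m / 2)) + (n % 2 + 2 * (n / 2))
    ≡⟨ cong₂ _+_ (m≡m%2+2*[m/2] m) (m≡m%2+2*[m/2] n) ⟨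
  m + n ∎
  where
  open ≤-Reasoning
  interchange : ∀ a b c d → (a + b) + 2 * (c + d) ≡ (a + 2 * c) + (b + 2 * d)
  interchange = solve-∀

xorF-assoc : ∀ K a b c → xorF K (xorF K a b) c ≡ xorF K a (xorF K b c)
xorF-assoc zero    a b c = refl
xorF-assoc (suc K) a b c
  rewrite [b+2r]%2≡b (xorF K (a / 2) (b / 2)) (bitXor≤1 (a % 2) (b % 2))
        | [b+2r]/2≡r (xorF K (a / 2) (b / 2)) (bitXor≤1 (a % 2) (b % 2))
        | [b+2r]%2≡b (xorF K (b / 2) (c / 2)) (bitXor≤1 (b % 2) (c % 2))
        | [b+2r]/2≡r (xorF K (b / 2) (c / 2)) (bitXor≤1 (b % 2) (c % 2))
  = cong₂ (λ x r → x + 2 * r) (bitXor-assoc (m%2≤1 a) (m%2≤1 b) (m%2≤1 c))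
                              (xorF-assoc K (a / 2) (b / 2) (c / 2))

⊕-comm : ∀ m n → m ⊕ n ≡ n ⊕ m
⊕-comm m n = begin
  m ⊕ n           ≡⟨ ⊕-as-xorF (m≤m+n m n) (m≤n+m n m) ⟩
  xorF (m + n) m n ≡⟨ xorF-comm (m + n) m n ⟩
  xorF (m + n) n m ≡⟨ ⊕-as-xorF (m≤n+m n m) (m≤m+n m n) ⟨
  n ⊕ m           ∎
  where open ≡-Reasoning

⊕-identityʳ : ∀ m → m ⊕ 0 ≡ m
⊕-identityʳ m = trans (⊕-as-xorF (≤-refl {m}) z≤n) (xorF-identityʳ ≤-refl)

⊕-identityˡ : ∀ m → 0 ⊕ m ≡ m
⊕-identityˡ m = trans (⊕-comm 0 m) (⊕-identityʳ m)

⊕-same : ∀ m → m ⊕ m ≡ 0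
⊕-same m = trans (⊕-as-xorF (≤-refl {m}) ≤-refl) (xorF-same m m)

⊕≤+ : ∀ m n → m ⊕ n ≤ m + n
⊕≤+ m n = xorF≤+ (suc (m + n)) m n

⊕-assoc : ∀ a b c → (a ⊕ b) ⊕ c ≡ a ⊕ (b ⊕ c)
⊕-assoc a b c = begin
  (a ⊕ b) ⊕ c              ≡⟨ ⊕-as-xorF (≤-trans (⊕≤+ a b) (m≤m+n (a + b) c)) c≤K ⟩
  xorF K (a ⊕ b) c         ≡⟨ cong (λ x → xorF K x c) (⊕-as-xorF a≤K b≤K) ⟩
  xorF K (xorF K a b) c    ≡⟨ xorF-assoc K a b c ⟩
  xorF K a (xorF K b c)    ≡⟨ cong (xorF K a) (⊕-as-xorF b≤K c≤K) ⟨
  xorF K a (b ⊕ c)         ≡⟨ ⊕-as-xorF a≤K (≤-trans (⊕≤+ b c) b+c≤K) ⟨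
  a ⊕ (b ⊕ c)              ∎
  where
  open ≡-Reasoning
  K = a + b + c
  a≤K : a ≤ K
  a≤K = ≤-trans (m≤m+n a b) (m≤m+n (a + b) c)
  b≤K : b ≤ K
  b≤K = ≤-trans (m≤n+m b a) (m≤m+n (a + b) c)
  c≤K : c ≤ K
  c≤K = m≤n+m c (a + b)
  b+c≤K : b + c ≤ K
  b+c≤K = subst (b + c ≤_) (sym (+-assoc a b c)) (m≤n+m (b + c) a)

⊕-cancelˡ : ∀ a b → a ⊕ (a ⊕ b) ≡ b
⊕-cancelˡ a b = begin
  a ⊕ (a ⊕ b)  ≡⟨ ⊕-assoc a a b ⟨
  (a ⊕ a) ⊕ b  ≡⟨ cong (_⊕ b) (⊕-same a) ⟩
  0 ⊕ b        ≡⟨ ⊕-identityˡ b ⟩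
  b            ∎
  where open ≡-Reasoning

⊕-on-bits : ∀ {x y} r s → x ≤ 1 → y ≤ 1 → (x + 2 * r) ⊕ (y + 2 * s) ≡ bitXor x y + 2 * (r ⊕ s)
⊕-on-bits {x} {y} r s x≤1 y≤1 = trans (⊕-unfold (x + 2 * r) (y + 2 * s))
  (cong₂ (λ b q → b + 2 * q) (cong₂ bitXor ([b+2r]%2≡b r x≤1) ([b+2r]%2≡b s y≤1))
                             (cong₂ _⊕_ ([b+2r]/2≡r r x≤1) ([b+2r]/2≡r s y≤1)))

<2^[1+k]⇒/2<2^k : ∀ {u} k → u < 2 ^ suc k → u / 2 < 2 ^ k
<2^[1+k]⇒/2<2^k {u} k h = m<n*o⇒m/o<n (subst (u <_) (*-comm 2 (2 ^ k)) h)

⊕-digits : ∀ k {u w} a b → u < 2 ^ k → w < 2 ^ k →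
  (u + 2 ^ k * a) ⊕ (w + 2 ^ k * b) ≡ (u ⊕ w) + 2 ^ k * (a ⊕ b)
⊕-digits zero    a b (s≤s z≤n) (s≤s z≤n) =
  trans (cong₂ _⊕_ (+-identityʳ a) (+-identityʳ b)) (sym (+-identityʳ (a ⊕ b)))
⊕-digits (suc k) {u} {w} a b u< w< = begin
  (u + 2 ^ suc k * a) ⊕ (w + 2 ^ suc k * b)
    ≡⟨ cong₂ _⊕_ (lowBit u a) (lowBit w b) ⟩
  (u % 2 + 2 * (u / 2 + 2 ^ k * a)) ⊕ (w % 2 + 2 * (w / 2 + 2 ^ k * b))
    ≡⟨ ⊕-on-bits (u / 2 + 2 ^ k * a) (w / 2 + 2 ^ k * b) (m%2≤1 u) (m%2≤1 w) ⟩
  bitXor (u % 2) (w % 2) + 2 * ((u / 2 + 2 ^ k * a) ⊕ (w / 2 + 2 ^ k * b))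
    ≡⟨ cong (λ r → bitXor (u % 2) (w % 2) + 2 * r)
         (⊕-digits k a b (<2^[1+k]⇒/2<2^k k u<) (<2^[1+k]⇒/2<2^k k w<)) ⟩
  bitXor (u % 2) (w % 2) + 2 * (((u / 2) ⊕ (w / 2)) + 2 ^ k * (a ⊕ b))
    ≡⟨ shift (bitXor (u % 2) (w % 2)) ((u / 2) ⊕ (w / 2)) (2 ^ k) (a ⊕ b) ⟩
  (bitXor (u % 2) (w % 2) + 2 * ((u / 2) ⊕ (w / 2))) + 2 ^ suc k * (a ⊕ b)
    ≡⟨ cong (_+ 2 ^ suc k * (a ⊕ b)) (⊕-unfold u w) ⟨
  (u ⊕ w) + 2 ^ suc k * (a ⊕ b) ∎
  where
  open ≡-Reasoning
  shift : ∀ x r p y → x + 2 * (r + p * y) ≡ (x + 2 * r) + 2 * p * y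
  shift = solve-∀
  regroup : ∀ x h p a → x + 2 * h + 2 * p * a ≡ x + 2 * (h + p * a)
  regroup = solve-∀
  lowBit : ∀ u a → u + 2 ^ suc k * a ≡ u % 2 + 2 * (u / 2 + 2 ^ k * a)
  lowBit u a = trans (cong (_+ 2 ^ suc k * a) (m≡m%2+2*[m/2] u)) (regroup (u % 2) (u / 2) (2 ^ k) a)

⊕-<-2^k : ∀ k {u w} → u < 2 ^ k → w < 2 ^ k → u ⊕ w < 2 ^ k
⊕-<-2^k zero    (s≤s z≤n) (s≤s z≤n) = s≤s z≤n
⊕-<-2^k (suc k) {u} {w} u< w< = begin-strict
  u ⊕ w                               ≡⟨ ⊕-unfold u w ⟩
  bitXor (u % 2) (w % 2) + 2 * r      <⟨ s≤s (+-monoˡ-≤ (2 * r) (bitXor≤1 (u % 2) (w % 2))) ⟩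
  2 + 2 * r                           ≡⟨ *-distribˡ-+ 2 1 r ⟨
  2 * suc r                           ≤⟨ *-monoʳ-≤ 2 (⊕-<-2^k k (<2^[1+k]⇒/2<2^k k u<)
                                                                 (<2^[1+k]⇒/2<2^k k w<)) ⟩
  2 ^ suc k                           ∎
  where
  open ≤-Reasoning
  r = (u / 2) ⊕ (w / 2)

⊕-digits₄ : ∀ k {u₁ u₂ u₃ u₄} a₁ a₂ a₃ a₄ → u₁ < 2 ^ k → u₂ < 2 ^ k → u₃ < 2 ^ k → u₄ < 2 ^ k →
  (u₁ + 2 ^ k * a₁) ⊕ ((u₂ + 2 ^ k * a₂) ⊕ ((u₃ + 2 ^ k * a₃) ⊕ (u₄ + 2 ^ k * a₄)))
  ≡ (u₁ ⊕ (u₂ ⊕ (u₃ ⊕ u₄))) + 2 ^ k * (a₁ ⊕ (a₂ ⊕ (a₃ ⊕ a₄)))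
⊕-digits₄ k {u₁} {u₂} {u₃} {u₄} a₁ a₂ a₃ a₄ u₁< u₂< u₃< u₄< = begin
  (u₁ + 2 ^ k * a₁) ⊕ ((u₂ + 2 ^ k * a₂) ⊕ ((u₃ + 2 ^ k * a₃) ⊕ (u₄ + 2 ^ k * a₄)))
    ≡⟨ cong (λ w → (u₁ + 2 ^ k * a₁) ⊕ ((u₂ + 2 ^ k * a₂) ⊕ w)) (⊕-digits k a₃ a₄ u₃< u₄<) ⟩
  (u₁ + 2 ^ k * a₁) ⊕ ((u₂ + 2 ^ k * a₂) ⊕ ((u₃ ⊕ u₄) + 2 ^ k * (a₃ ⊕ a₄)))
    ≡⟨ cong ((u₁ + 2 ^ k * a₁) ⊕_) (⊕-digits k a₂ (a₃ ⊕ a₄) u₂< u₃₄<) ⟩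
  (u₁ + 2 ^ k * a₁) ⊕ ((u₂ ⊕ (u₃ ⊕ u₄)) + 2 ^ k * (a₂ ⊕ (a₃ ⊕ a₄)))
    ≡⟨ ⊕-digits k a₁ (a₂ ⊕ (a₃ ⊕ a₄)) u₁< (⊕-<-2^k k u₂< u₃₄<) ⟩
  (u₁ ⊕ (u₂ ⊕ (u₃ ⊕ u₄))) + 2 ^ k * (a₁ ⊕ (a₂ ⊕ (a₃ ⊕ a₄))) ∎
  where
  open ≡-Reasoning
  u₃₄< : u₃ ⊕ u₄ < 2 ^ k
  u₃₄< = ⊕-<-2^k k u₃< u₄<

⊕-assoc₄ : ∀ a b c d r → a ⊕ (b ⊕ (c ⊕ (d ⊕ r))) ≡ (a ⊕ (b ⊕ (c ⊕ d))) ⊕ r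
⊕-assoc₄ a b c d r = begin
  a ⊕ (b ⊕ (c ⊕ (d ⊕ r)))  ≡⟨ cong (λ w → a ⊕ (b ⊕ w)) (⊕-assoc c d r) ⟨
  a ⊕ (b ⊕ ((c ⊕ d) ⊕ r))  ≡⟨ cong (a ⊕_) (⊕-assoc b (c ⊕ d) r) ⟨
  a ⊕ ((b ⊕ (c ⊕ d)) ⊕ r)  ≡⟨ ⊕-assoc a (b ⊕ (c ⊕ d)) r ⟨
  (a ⊕ (b ⊕ (c ⊕ d))) ⊕ r  ∎
  where open ≡-Reasoning

nimSumBy : (ℕ → ℕ) → ∀ {p} → Vec ℕ p → ℕ
nimSumBy f = Vec.foldr _ (λ h acc → f h ⊕ acc) 0

nimSumBy-cong : ∀ {f g p} {hs : Vec ℕ p} → All (λ h → f h ≡ g h) hs → nimSumBy f hs ≡ nimSumBy g hs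
nimSumBy-cong []       = refl
nimSumBy-cong (e ∷ es) = cong₂ _⊕_ e (nimSumBy-cong es)

nimSumBy-swap₄ : ∀ f {p} b₁ b₂ b₃ b₄ a₁ a₂ a₃ a₄ (rest : Vec ℕ p) →
  f b₁ ⊕ (f b₂ ⊕ (f b₃ ⊕ f b₄)) ≡ f a₁ ⊕ (f a₂ ⊕ (f a₃ ⊕ f a₄)) →
  nimSumBy f (b₁ ∷ b₂ ∷ b₃ ∷ b₄ ∷ rest) ≡ nimSumBy f (a₁ ∷ a₂ ∷ a₃ ∷ a₄ ∷ rest)
nimSumBy-swap₄ f b₁ b₂ b₃ b₄ a₁ a₂ a₃ a₄ rest eq =
  trans (⊕-assoc₄ (f b₁) (f b₂) (f b₃) (f b₄) R)
    (trans (cong (_⊕ R) eq) (sym (⊕-assoc₄ (f a₁) (f a₂) (f a₃) (f a₄) R)))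
  where
  R : ℕ
  R = nimSumBy f rest

sum-swap₄ : ∀ {p} b₁ b₂ b₃ b₄ a₁ a₂ a₃ a₄ (rest : Vec ℕ p) →
  b₁ + (b₂ + (b₃ + b₄)) ≡ a₁ + (a₂ + (a₃ + a₄)) →
  Vec.sum (b₁ ∷ b₂ ∷ b₃ ∷ b₄ ∷ rest) ≡ Vec.sum (a₁ ∷ a₂ ∷ a₃ ∷ a₄ ∷ rest)
sum-swap₄ b₁ b₂ b₃ b₄ a₁ a₂ a₃ a₄ rest eq =
  trans (assoc₄ b₁ b₂ b₃ b₄ r) (trans (cong (_+ r) eq) (sym (assoc₄ a₁ a₂ a₃ a₄ r)))
  where
  r : ℕ
  r = Vec.sum rest
  assoc₄ : ∀ a b c d r → a + (b + (c + (d + r))) ≡ (a + (b + (c + d))) + r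
  assoc₄ = solve-∀

parts≤sum : ∀ {p} (hs : Vec ℕ p) → All (_≤ Vec.sum hs) hs
parts≤sum []       = []
parts≤sum (h ∷ hs) = m≤m+n h _ ∷ All.map (λ h′≤ → ≤-trans h′≤ (m≤n+m _ h)) (parts≤sum hs)

agree-on-parts : ∀ {f g : ℕ → ℕ} {n p} {hs : Vec ℕ p} → (∀ m → 1 ≤ m → m ≤ n → f m ≡ g m) →
  IsPartition n p hs → All (λ h → f h ≡ g h) hs
agree-on-parts {hs = hs} f≡g (positive , refl) =
  All.map (λ (1≤h , h≤n) → f≡g _ 1≤h h≤n) (All.zip (positive , parts≤sum hs))

-- The sequence s on a block of length 12c, uniformly in c ≥ 2

[qN+r]/N≡q : ∀ q {r N} .{{_ : NonZero N}} → r < N → (q * N + r) / N ≡ q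
[qN+r]/N≡q q {r} {N} r<N = begin
  (q * N + r) / N    ≡⟨ +-distrib-/-∣ˡ r (n∣m*n q) ⟩
  q * N / N + r / N  ≡⟨ cong₂ _+_ (m*n/n≡m q N) (m<n⇒m/n≡0 r<N) ⟩
  q + 0              ≡⟨ +-identityʳ q ⟩
  q                  ∎
  where open ≡-Reasoning

[qN+r]%N≡r : ∀ q {r N} .{{_ : NonZero N}} → r < N → (q * N + r) % N ≡ r
[qN+r]%N≡r q r<N = trans (%-remove-+ˡ _ (n∣m*n q)) (m<n⇒m%n≡m r<N)

s-block : ∀ c q {m} → 1 ≤ m → m ≤ 12 * suc c →
  s (suc c) (q * (12 * suc c) + m) ≡ 8 * q + t (suc c) m
s-block c q {suc m} _ m<N
  rewrite +-suc (q * (12 * suc c)) m | [qN+r]/N≡q q m<N | [qN+r]%N≡r q m<N | +-comm m 1 = refl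

T⇒≡true : ∀ {b} → T b → b ≡ true
T⇒≡true = Equivalence.to T-≡

¬T⇒≡false : ∀ {b} → ¬ T b → b ≡ false
¬T⇒≡false {true}  ¬b = contradiction tt ¬b
¬T⇒≡false {false} _  = refl

linear≤ᵇ : ℕ → ℕ → ℕ → ℕ → Bool
linear≤ᵇ α β α′ β′ = (α ≤ᵇ α′) ∧ (β ≤ᵇ β′ + 2 * (α′ ∸ α))

linear≤ᵇ-sound : ∀ {c} α β α′ β′ → 2 ≤ c → T (linear≤ᵇ α β α′ β′) → α * c + β ≤ α′ * c + β′
linear≤ᵇ-sound {c} α β α′ β′ 2≤c h with Equivalence.to T-∧ h
... | α≤α′ , β≤ = begin
  α * c + β               ≤⟨ +-monoʳ-≤ (α * c) (≤ᵇ⇒≤ β _ β≤) ⟩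
  α * c + (β′ + 2 * δ)    ≤⟨ +-monoʳ-≤ (α * c) (+-monoʳ-≤ β′ (*-monoˡ-≤ δ 2≤c)) ⟩
  α * c + (β′ + c * δ)    ≡⟨ regroup α β′ δ c ⟩
  (α + δ) * c + β′        ≡⟨ cong (λ x → x * c + β′) (m+[n∸m]≡n (≤ᵇ⇒≤ α α′ α≤α′)) ⟩
  α′ * c + β′             ∎
  where
  open ≤-Reasoning
  δ = α′ ∸ α
  regroup : ∀ α β′ δ c → α * c + (β′ + c * δ) ≡ (α + δ) * c + β′
  regroup = solve-∀

-- The value of (α c + β ≤ᵇ α′ c + β′), when it is the same for every c ≥ 2.
≤ᵇ-uniform : ℕ → ℕ → ℕ → ℕ → Maybe Bool
≤ᵇ-uniform α β α′ β′ =
  if linear≤ᵇ α β α′ β′ then just true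
  else if linear≤ᵇ α′ (suc β′) α β then just false
  else nothing

≤ᵇ-uniform-sound : ∀ {c b} α β α′ β′ → 2 ≤ c → ≤ᵇ-uniform α β α′ β′ ≡ just b →
  (α * c + β ≤ᵇ α′ * c + β′) ≡ b
≤ᵇ-uniform-sound α β α′ β′ 2≤c eq with linear≤ᵇ α β α′ β′ in le
≤ᵇ-uniform-sound α β α′ β′ 2≤c refl | true =
  T⇒≡true (≤⇒≤ᵇ (linear≤ᵇ-sound α β α′ β′ 2≤c (subst T (sym le) tt)))
... | false with linear≤ᵇ α′ (suc β′) α β in gt
≤ᵇ-uniform-sound {c} α β α′ β′ 2≤c refl | false | true = ¬T⇒≡false λ h →
  <⇒≱ (subst (_≤ α * c + β) (+-suc (α′ * c) β′) (linear≤ᵇ-sound α′ (suc β′) α β 2≤c (subst T (sym gt) tt)))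
      (≤ᵇ⇒≤ _ _ h)

≤ᵇ-uniform-sound-multiple : ∀ {c b} α β j → 2 ≤ c → ≤ᵇ-uniform α β j 0 ≡ just b → (α * c + β ≤ᵇ j * c) ≡ b
≤ᵇ-uniform-sound-multiple {c} {b} α β j 2≤c e =
  subst (λ x → (α * c + β ≤ᵇ x) ≡ b) (+-identityʳ (j * c)) (≤ᵇ-uniform-sound α β j 0 2≤c e)

-- The value of (α c + β ≡ᵇ α′ c + β′), when it is the same for every c ≥ 2.
≡ᵇ-uniform : ℕ → ℕ → ℕ → ℕ → Maybe Bool
≡ᵇ-uniform α β α′ β′ =
  if (α ≡ᵇ α′) ∧ (β ≡ᵇ β′) then just true
  else if linear≤ᵇ α (suc β) α′ β′ then just false
  else if linear≤ᵇ α′ (suc β′) α β then just false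
  else nothing

≡ᵇ-uniform-sound : ∀ {c b} α β α′ β′ → 2 ≤ c → ≡ᵇ-uniform α β α′ β′ ≡ just b →
  (α * c + β ≡ᵇ α′ * c + β′) ≡ b
≡ᵇ-uniform-sound α β α′ β′ 2≤c eq with (α ≡ᵇ α′) ∧ (β ≡ᵇ β′) in same
≡ᵇ-uniform-sound {c} α β α′ β′ 2≤c refl | true with Equivalence.to T-∧ (subst T (sym same) tt)
... | α≡ , β≡ rewrite ≡ᵇ⇒≡ α α′ α≡ | ≡ᵇ⇒≡ β β′ β≡ = T⇒≡true (≡⇒≡ᵇ (α′ * c + β′) _ refl)
≡ᵇ-uniform-sound α β α′ β′ 2≤c eq | false with linear≤ᵇ α (suc β) α′ β′ in lt
≡ᵇ-uniform-sound {c} α β α′ β′ 2≤c refl | false | true = ¬T⇒≡false λ h →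
  <⇒≢ (subst (_≤ α′ * c + β′) (+-suc (α * c) β) (linear≤ᵇ-sound α (suc β) α′ β′ 2≤c (subst T (sym lt) tt)))
      (≡ᵇ⇒≡ _ _ h)
... | false with linear≤ᵇ α′ (suc β′) α β in gt
≡ᵇ-uniform-sound {c} α β α′ β′ 2≤c refl | false | false | true = ¬T⇒≡false λ h →
  <⇒≢ (subst (_≤ α * c + β) (+-suc (α′ * c) β′) (linear≤ᵇ-sound α′ (suc β′) α β 2≤c (subst T (sym gt) tt)))
      (sym (≡ᵇ⇒≡ _ _ h))

tBranches : Bool → Bool → Bool → Bool → Bool → Bool → Bool → ℕ
tBranches b₁ b₂ b₃ b₄ b₅ b₆ odd =
  if b₁ then (if odd then 0 else 1)
  else if b₂ then (if odd then 2 else 3)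
  else if b₃ then 1
  else if b₄ then (if odd then 5 else 4)
  else if b₅ then (if odd then 3 else 2)
  else if b₆ then (if odd then 4 else 5)
  else (if odd then 6 else 7)

-- t c (α c + β), when it is the same for every c ≥ 2; α must be even, so that the parity is that of β.
tUniform : ℕ → ℕ → Maybe ℕ
tUniform α β with α % 2 ≡ᵇ 0 | ≤ᵇ-uniform α β 2 0 | ≤ᵇ-uniform α β 4 0 | ≡ᵇ-uniform α β 4 1
                 | ≤ᵇ-uniform α β 6 0 | ≤ᵇ-uniform α β 8 0 | ≤ᵇ-uniform α β 10 0
... | true | just b₁ | just b₂ | just b₃ | just b₄ | just b₅ | just b₆ =
  just (tBranches b₁ b₂ b₃ b₄ b₅ b₆ (isOdd β))
... | _    | _       | _       | _       | _       | _       | _       = nothing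

isOdd-even+ : ∀ α c β → α % 2 ≡ 0 → isOdd (α * c + β) ≡ isOdd β
isOdd-even+ α c β α-even =
  cong (_≡ᵇ 1) (%-remove-+ˡ β (∣m⇒∣m*n c (m%n≡0⇒n∣m α 2 α-even)))

tUniform-sound : ∀ {c v} α β → 2 ≤ c → tUniform α β ≡ just v → t c (α * c + β) ≡ v
tUniform-sound {c} α β 2≤c eq
  with α % 2 ≡ᵇ 0 in e₀ | ≤ᵇ-uniform α β 2 0 in e₁ | ≤ᵇ-uniform α β 4 0 in e₂ | ≡ᵇ-uniform α β 4 1 in e₃
     | ≤ᵇ-uniform α β 6 0 in e₄ | ≤ᵇ-uniform α β 8 0 in e₅ | ≤ᵇ-uniform α β 10 0 in e₆
tUniform-sound {c} α β 2≤c refl | true | just b₁ | just b₂ | just b₃ | just b₄ | just b₅ | just b₆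
  rewrite ≤ᵇ-uniform-sound-multiple α β 2 2≤c e₁ | ≤ᵇ-uniform-sound-multiple α β 4 2≤c e₂
        | ≡ᵇ-uniform-sound α β 4 1 2≤c e₃ | ≤ᵇ-uniform-sound-multiple α β 6 2≤c e₄
        | ≤ᵇ-uniform-sound-multiple α β 8 2≤c e₅ | ≤ᵇ-uniform-sound-multiple α β 10 2≤c e₆
        | isOdd-even+ α c β (≡ᵇ⇒≡ _ 0 (subst T (sym e₀) tt)) = refl

residueValue : ℕ → ℕ → Maybe ℕ
residueValue α β = if linear≤ᵇ 0 1 α β ∧ linear≤ᵇ α β 12 0 then tUniform α β else nothing

residueValue-inBlock : ∀ {c v} α β → 2 ≤ c → residueValue α β ≡ just v →
  1 ≤ α * c + β × α * c + β ≤ 12 * c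
residueValue-inBlock {c} α β 2≤c eq with linear≤ᵇ 0 1 α β ∧ linear≤ᵇ α β 12 0 in inBlock
... | true with Equivalence.to T-∧ (subst T (sym inBlock) tt)
...   | pos , below = linear≤ᵇ-sound 0 1 α β 2≤c pos ,
  subst (α * c + β ≤_) (+-identityʳ (12 * c)) (linear≤ᵇ-sound α β 12 0 2≤c below)

residueValue-sound : ∀ {c v} α β → 2 ≤ c → residueValue α β ≡ just v → t c (α * c + β) ≡ v
residueValue-sound α β 2≤c eq with linear≤ᵇ 0 1 α β ∧ linear≤ᵇ α β 12 0
... | true = tUniform-sound α β 2≤c eq

s-residue : ∀ {c v} q α β → 2 ≤ c → residueValue α β ≡ just v →
  s c (q * (12 * c) + (α * c + β)) ≡ v + 8 * q
s-residue {suc (suc d)} {v} q α β 2≤c@(s≤s (s≤s z≤n)) eq = begin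
  s c (q * (12 * c) + (α * c + β))  ≡⟨ s-block (suc d) q 1≤r r≤12c ⟩
  8 * q + t c (α * c + β)           ≡⟨ cong (8 * q +_) (residueValue-sound α β 2≤c eq) ⟩
  8 * q + v                         ≡⟨ +-comm (8 * q) v ⟩
  v + 8 * q                         ∎
  where
  open ≡-Reasoning
  c = suc (suc d)
  1≤r : 1 ≤ α * c + β
  1≤r = proj₁ (residueValue-inBlock α β 2≤c eq)
  r≤12c : α * c + β ≤ 12 * c
  r≤12c = proj₂ (residueValue-inBlock α β 2≤c eq)

-- Outnumbers

data OutClass : Set where
  2c 4c 6c 8c 10c 12c 4c+1 : OutClass

coeff : OutClass → ℕ
coeff 2c   = 2
coeff 4c   = 4
coeff 6c   = 6
coeff 8c   = 8
coeff 10c  = 10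
coeff 12c  = 12
coeff 4c+1 = 4

offset : OutClass → ℕ
offset 4c+1 = 1
offset _    = 0

residue : ℕ → OutClass → ℕ
residue c k = coeff k * c + offset k

outnumberOf : ℕ → ℕ → OutClass → ℕ
outnumberOf c q k = q * (12 * c) + residue c k

classValue : OutClass → ℕ
classValue 2c   = 1
classValue 4c   = 3
classValue 6c   = 4
classValue 8c   = 2
classValue 10c  = 5
classValue 12c  = 7
classValue 4c+1 = 1

classValue<8 : ∀ k → classValue k < 8
classValue<8 2c   = s≤s (s≤s z≤n)
classValue<8 4c   = s≤s (s≤s (s≤s (s≤s z≤n)))
classValue<8 6c   = s≤s (s≤s (s≤s (s≤s (s≤s z≤n))))
classValue<8 8c   = s≤s (s≤s (s≤s z≤n))
classValue<8 10c  = s≤s (s≤s (s≤s (s≤s (s≤s (s≤s z≤n)))))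
classValue<8 12c  = s≤s (s≤s (s≤s (s≤s (s≤s (s≤s (s≤s (s≤s z≤n)))))))
classValue<8 4c+1 = s≤s (s≤s z≤n)

residueValue-class : ∀ k → residueValue (coeff k) (offset k) ≡ just (classValue k)
residueValue-class 2c   = refl
residueValue-class 4c   = refl
residueValue-class 6c   = refl
residueValue-class 8c   = refl
residueValue-class 10c  = refl
residueValue-class 12c  = refl
residueValue-class 4c+1 = refl

s-outnumber : ∀ {c} q k → 2 ≤ c → s c (outnumberOf c q k) ≡ classValue k + 8 * q
s-outnumber q k 2≤c = s-residue q (coeff k) (offset k) 2≤c (residueValue-class k)

evenClass : ℕ → OutClass
evenClass 0 = 2c
evenClass 1 = 4c
evenClass 2 = 6c
evenClass 3 = 8c
evenClass 4 = 10c
evenClass _ = 12c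

residue-evenClass : ∀ c {r} → r < 6 → residue c (evenClass r) ≡ (2 + 2 * r) * c
residue-evenClass c {0} _ = +-identityʳ _
residue-evenClass c {1} _ = +-identityʳ _
residue-evenClass c {2} _ = +-identityʳ _
residue-evenClass c {3} _ = +-identityʳ _
residue-evenClass c {4} _ = +-identityʳ _
residue-evenClass c {5} _ = +-identityʳ _
residue-evenClass c {suc (suc (suc (suc (suc (suc _)))))} (s≤s (s≤s (s≤s (s≤s (s≤s (s≤s ()))))))

outnumber-residue : ∀ c {a} → Outnumber (suc c) a →
  ∃₂ λ q k → a ≡ outnumberOf (suc c) q k
outnumber-residue c {a} (_ , inj₂ a%N≡4C+1) = a / N , 4c+1 , (begin
  a                                 ≡⟨ m≡m%n+[m/n]*n a N ⟩
  a % N + a / N * N                 ≡⟨ cong (_+ a / N * N) a%N≡4C+1 ⟩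
  4 * suc c + 1 + a / N * N         ≡⟨ +-comm (4 * suc c + 1) (a / N * N) ⟩
  a / N * N + residue (suc c) 4c+1  ∎)
  where
  open ≡-Reasoning
  N : ℕ
  N = 12 * suc c
outnumber-residue c {a} (1≤a , inj₁ a%M≡0) with a / (2 * suc c) in quot
... | zero  = contradiction (trans a≡ (cong (_* M) quot)) (≢-sym (<⇒≢ 1≤a))
  where
  M : ℕ
  M = 2 * suc c
  a≡ : a ≡ a / M * M
  a≡ = trans (m≡m%n+[m/n]*n a M) (cong (_+ a / M * M) a%M≡0)
... | suc j = j / 6 , evenClass (j % 6) , (begin
  a                                       ≡⟨ m≡m%n+[m/n]*n a M ⟩
  a % M + a / M * M                       ≡⟨ cong₂ (λ r q → r + q * M) a%M≡0 quot ⟩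
  suc j * M                               ≡⟨ cong (λ i → suc i * M) (m≡m%n+[m/n]*n j 6) ⟩
  suc (j % 6 + j / 6 * 6) * M             ≡⟨ blocks (j % 6) (j / 6) (suc c) ⟩
  j / 6 * N + (2 + 2 * (j % 6)) * suc c   ≡⟨ cong (j / 6 * N +_) (residue-evenClass (suc c) (m%n<n j 6)) ⟨
  j / 6 * N + residue (suc c) (evenClass (j % 6)) ∎)
  where
  open ≡-Reasoning
  M N : ℕ
  M = 2 * suc c
  N = 12 * suc c
  blocks : ∀ r q C → suc (r + q * 6) * (2 * C) ≡ q * (12 * C) + (2 + 2 * r) * C
  blocks = solve-∀

≡1[mod2c]⇒¬outnumber : ∀ c {a} → a % (2 * suc c) ≡ 1 → a < 4 * suc c + 1 → ¬ Outnumber (suc c) a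
≡1[mod2c]⇒¬outnumber c a%2C≡1 _   (_ , inj₁ a%2C≡0)   = contradiction (trans (sym a%2C≡1) a%2C≡0) λ ()
≡1[mod2c]⇒¬outnumber c {a} _ a<4C+1 (_ , inj₂ a%N≡4C+1) =
  <⇒≢ (≤-<-trans (m%n≤m a (12 * suc c)) a<4C+1) a%N≡4C+1

-- The search for a rearrangement

-- U is the nim-sum of the values, A and B the sums of the coefficients and offsets of the
-- residues of four exiting parts.
record Rearrangement (U A B : ℕ) : Set where
  field
    σ v α β h e : ℕ
    σ∈ : σ ≡ 0 ⊎ σ ≡ 2
    z-value : residueValue α β ≡ just v
    v<8 : v < 8
    nim-balance : σ ⊕ v ≡ U
    coeff-balance : 2 * h + α + σ ≡ A
    offset-balance : 4 * h + B ≡ β + 1 + 2 * e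
    1≤e : 1 ≤ e

rearrangementVia : ∀ U A B σ → σ ≡ 0 ⊎ σ ≡ 2 → ℕ × ℕ → Maybe (Rearrangement U A B)
rearrangementVia U A B σ σ∈ (α , β) = do
  z-value ← dec⇒maybe (≡-dec _≟_ (residueValue α β) (just v))
  v<8 ← dec⇒maybe (v <? 8)
  nim-balance ← dec⇒maybe (σ ⊕ v ≟ U)
  coeff-balance ← dec⇒maybe (2 * h + α + σ ≟ A)
  offset-balance ← dec⇒maybe (4 * h + B ≟ β + 1 + 2 * e)
  1≤e ← dec⇒maybe (1 ≤? e)
  just record { σ = σ ; v = v ; α = α ; β = β ; h = h ; e = e ; σ∈ = σ∈ ; z-value = z-value ; v<8 = v<8
              ; nim-balance = nim-balance ; coeff-balance = coeff-balance
              ; offset-balance = offset-balance ; 1≤e = 1≤e }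
  where
  v h e : ℕ
  v = U ⊕ σ
  h = (A ∸ α ∸ σ) / 2
  e = (4 * h + B ∸ β ∸ 1) / 2

zResidues : List (ℕ × ℕ)
zResidues = cartesianProduct (0 ∷ 2 ∷ 4 ∷ 6 ∷ 8 ∷ 10 ∷ []) (1 ∷ 2 ∷ 3 ∷ [])

rearrangement? : ∀ U A B → Maybe (Rearrangement U A B)
rearrangement? U A B = foldr (λ r found → via r <∣> found) nothing zResidues
  where
  via : ℕ × ℕ → Maybe (Rearrangement U A B)
  via r = rearrangementVia U A B 0 (inj₁ refl) r <∣> rearrangementVia U A B 2 (inj₂ refl) r

classes : List OutClass
classes = 2c ∷ 4c ∷ 6c ∷ 8c ∷ 10c ∷ 12c ∷ 4c+1 ∷ []

∈-classes : ∀ k → k ∈ classes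
∈-classes 2c   = here refl
∈-classes 4c   = there (here refl)
∈-classes 6c   = there (there (here refl))
∈-classes 8c   = there (there (there (here refl)))
∈-classes 10c  = there (there (there (there (here refl))))
∈-classes 12c  = there (there (there (there (there (here refl)))))
∈-classes 4c+1 = there (there (there (there (there (there (here refl))))))

forAllClasses : ∀ {f : OutClass → Bool} → T (all f classes) → ∀ k → T (f k)
forAllClasses {f} holds k = ListAll.lookup (all⁺ f classes holds) (∈-classes k)

forAllQuadruples : (OutClass → OutClass → OutClass → OutClass → Bool) → Bool
forAllQuadruples f = all (λ k₁ → all (λ k₂ → all (λ k₃ → all (f k₁ k₂ k₃) classes) classes) classes) classes

forAllQuadruples-sound : ∀ f → T (forAllQuadruples f) → ∀ k₁ k₂ k₃ k₄ → T (f k₁ k₂ k₃ k₄)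
forAllQuadruples-sound f holds k₁ k₂ k₃ k₄ =
  forAllClasses {f k₁ k₂ k₃}
    (forAllClasses {λ k₃ → all (f k₁ k₂ k₃) classes}
      (forAllClasses {λ k₂ → all (λ k₃ → all (f k₁ k₂ k₃) classes) classes}
        (forAllClasses {λ k₁ → all (λ k₂ → all (λ k₃ → all (f k₁ k₂ k₃) classes) classes) classes}
          holds k₁) k₂) k₃) k₄

Σ⊕ : (OutClass → ℕ) → OutClass → OutClass → OutClass → OutClass → ℕ
Σ⊕ f k₁ k₂ k₃ k₄ = f k₁ ⊕ (f k₂ ⊕ (f k₃ ⊕ f k₄))

Σ+ : (OutClass → ℕ) → OutClass → OutClass → OutClass → OutClass → ℕ
Σ+ f k₁ k₂ k₃ k₄ = f k₁ + (f k₂ + (f k₃ + f k₄))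

rearrangeable : OutClass → OutClass → OutClass → OutClass → Bool
rearrangeable k₁ k₂ k₃ k₄ =
  is-just (rearrangement? (Σ⊕ classValue k₁ k₂ k₃ k₄) (Σ+ coeff k₁ k₂ k₃ k₄) (Σ+ offset k₁ k₂ k₃ k₄))

-- Opaque, so that type checking never unfolds the search.
opaque
  rearrangement : ∀ k₁ k₂ k₃ k₄ →
    Rearrangement (Σ⊕ classValue k₁ k₂ k₃ k₄) (Σ+ coeff k₁ k₂ k₃ k₄) (Σ+ offset k₁ k₂ k₃ k₄)
  rearrangement k₁ k₂ k₃ k₄ =
    to-witness-T (rearrangement? (Σ⊕ classValue k₁ k₂ k₃ k₄) (Σ+ coeff k₁ k₂ k₃ k₄) (Σ+ offset k₁ k₂ k₃ k₄))
      (forAllQuadruples-sound rearrangeable _ k₁ k₂ k₃ k₄)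

-- Replacing four exiting parts

¬outnumber-σc+1 : ∀ c {σ} → σ ≡ 0 ⊎ σ ≡ 2 → ¬ Outnumber (suc c) (σ * suc c + 1)
¬outnumber-σc+1 c σ∈ = ≡1[mod2c]⇒¬outnumber c (≡1-mod-2C σ∈) (<4C+1 σ∈)
  where
  C : ℕ
  C = suc c
  1<2C : 1 < 2 * C
  1<2C = *-monoʳ-≤ 2 (s≤s z≤n)
  ≡1-mod-2C : ∀ {σ} → σ ≡ 0 ⊎ σ ≡ 2 → (σ * C + 1) % (2 * C) ≡ 1
  ≡1-mod-2C (inj₁ refl) = m<n⇒m%n≡m 1<2C
  ≡1-mod-2C (inj₂ refl) =
    trans (cong (_% (2 * C)) (+-comm (2 * C) 1)) (trans ([m+n]%n≡m%n 1 (2 * C)) (m<n⇒m%n≡m 1<2C))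
  <4C+1 : ∀ {σ} → σ ≡ 0 ⊎ σ ≡ 2 → σ * C + 1 < 4 * C + 1
  <4C+1 (inj₁ refl) = +-monoˡ-< 1 (s≤s z≤n)
  <4C+1 (inj₂ refl) = +-monoˡ-< 1 (*-monoˡ-< C {2} {4} (s≤s (s≤s (s≤s z≤n))))

residueValue-σc+1 : ∀ {σ} → σ ≡ 0 ⊎ σ ≡ 2 → residueValue σ 1 ≡ just σ
residueValue-σc+1 (inj₁ refl) = refl
residueValue-σc+1 (inj₂ refl) = refl

σ<8 : ∀ {σ} → σ ≡ 0 ⊎ σ ≡ 2 → σ < 8
σ<8 (inj₁ refl) = s≤s z≤n
σ<8 (inj₂ refl) = s≤s (s≤s (s≤s z≤n))

module Rearranged (d q₁ q₂ q₃ q₄ : ℕ) (k₁ k₂ k₃ k₄ : OutClass) {a₁ a₂ a₃ a₄ : ℕ}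
  (e₁ : a₁ ≡ outnumberOf (2 + d) q₁ k₁) (e₂ : a₂ ≡ outnumberOf (2 + d) q₂ k₂)
  (e₃ : a₃ ≡ outnumberOf (2 + d) q₃ k₃) (e₄ : a₄ ≡ outnumberOf (2 + d) q₄ k₄) where

  open Rearrangement (rearrangement k₁ k₂ k₃ k₄)

  c : ℕ
  c = 2 + d

  2≤c : 2 ≤ c
  2≤c = s≤s (s≤s z≤n)

  Q S : ℕ
  Q = q₁ ⊕ (q₂ ⊕ (q₃ ⊕ q₄))
  S = q₁ + (q₂ + (q₃ + q₄))

  x y z : ℕ
  x = (S ∸ Q) * (6 * c) + h * d + e
  y = σ * c + 1
  z = Q * (12 * c) + (α * c + β)

  -- Adding 4h to both sides turns the term h(c − 2) of x into a semiring identity.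
  parts-sum : x + (x + (y + z)) ≡ a₁ + (a₂ + (a₃ + a₄))
  parts-sum = +-cancelˡ-≡ (4 * h) _ _ (begin
    4 * h + (x + (x + (y + z)))
      ≡⟨ regroupNew (S ∸ Q) Q h d e σ α β ⟩
    (Q + (S ∸ Q)) * (12 * c) + ((2 * h + α + σ) * c + (β + 1 + 2 * e))
      ≡⟨ cong₂ (λ q r → q * (12 * c) + r) (m+[n∸m]≡n Q≤S)
               (cong₂ (λ a b → a * c + b) coeff-balance (sym offset-balance)) ⟩
    S * (12 * c) + (Σ+ coeff k₁ k₂ k₃ k₄ * c + (4 * h + Σ+ offset k₁ k₂ k₃ k₄))
      ≡⟨ regroupOld q₁ q₂ q₃ q₄ (coeff k₁) (coeff k₂) (coeff k₃) (coeff k₄)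
                    (offset k₁) (offset k₂) (offset k₃) (offset k₄) h c ⟩
    4 * h + (outnumberOf c q₁ k₁ + (outnumberOf c q₂ k₂ + (outnumberOf c q₃ k₃ + outnumberOf c q₄ k₄)))
      ≡⟨ cong (4 * h +_) (cong₂ _+_ e₁ (cong₂ _+_ e₂ (cong₂ _+_ e₃ e₄))) ⟨
    4 * h + (a₁ + (a₂ + (a₃ + a₄))) ∎)
    where
    open ≡-Reasoning
    Q≤S : Q ≤ S
    Q≤S = ≤-trans (⊕≤+ q₁ _) (+-monoʳ-≤ q₁ (≤-trans (⊕≤+ q₂ _) (+-monoʳ-≤ q₂ (⊕≤+ q₃ q₄))))
    regroupNew : ∀ D Q h d e σ α β →
      4 * h + ((D * (6 * (2 + d)) + h * d + e) + ((D * (6 * (2 + d)) + h * d + e)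
        + ((σ * (2 + d) + 1) + (Q * (12 * (2 + d)) + (α * (2 + d) + β)))))
      ≡ (Q + D) * (12 * (2 + d)) + ((2 * h + α + σ) * (2 + d) + (β + 1 + 2 * e))
    regroupNew = solve-∀
    regroupOld : ∀ q₁ q₂ q₃ q₄ α₁ α₂ α₃ α₄ β₁ β₂ β₃ β₄ h c →
      (q₁ + (q₂ + (q₃ + q₄))) * (12 * c) + ((α₁ + (α₂ + (α₃ + α₄))) * c + (4 * h + (β₁ + (β₂ + (β₃ + β₄)))))
      ≡ 4 * h + ((q₁ * (12 * c) + (α₁ * c + β₁)) + ((q₂ * (12 * c) + (α₂ * c + β₂))
        + ((q₃ * (12 * c) + (α₃ * c + β₃)) + (q₄ * (12 * c) + (α₄ * c + β₄)))))
    regroupOld = solve-∀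

  1≤x : 1 ≤ x
  1≤x = ≤-trans 1≤e (m≤n+m e _)

  1≤y : 1 ≤ y
  1≤y = m≤n+m 1 (σ * c)

  1≤z : 1 ≤ z
  1≤z = ≤-trans (proj₁ (residueValue-inBlock α β 2≤c z-value)) (m≤n+m _ (Q * (12 * c)))

  y-not-outnumber : ¬ Outnumber c y
  y-not-outnumber = ¬outnumber-σc+1 (suc d) σ∈

  s-preserved : s c y ⊕ s c z ≡ s c a₁ ⊕ (s c a₂ ⊕ (s c a₃ ⊕ s c a₄))
  s-preserved = begin
    s c y ⊕ s c z
      ≡⟨ cong₂ _⊕_ (s-residue 0 σ 1 2≤c (residueValue-σc+1 σ∈)) (s-residue Q α β 2≤c z-value) ⟩
    (σ + 8 * 0) ⊕ (v + 8 * Q)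
      ≡⟨ ⊕-digits 3 0 Q (σ<8 σ∈) v<8 ⟩
    (σ ⊕ v) + 8 * (0 ⊕ Q)
      ≡⟨ cong₂ (λ u q → u + 8 * q) nim-balance (⊕-identityˡ Q) ⟩
    Σ⊕ classValue k₁ k₂ k₃ k₄ + 8 * Q
      ≡⟨ ⊕-digits₄ 3 q₁ q₂ q₃ q₄ (classValue<8 k₁) (classValue<8 k₂) (classValue<8 k₃) (classValue<8 k₄) ⟨
    (classValue k₁ + 8 * q₁) ⊕ ((classValue k₂ + 8 * q₂)
      ⊕ ((classValue k₃ + 8 * q₃) ⊕ (classValue k₄ + 8 * q₄)))
      ≡⟨ cong₂ _⊕_ (s-part q₁ k₁ e₁) (cong₂ _⊕_ (s-part q₂ k₂ e₂)
           (cong₂ _⊕_ (s-part q₃ k₃ e₃) (s-part q₄ k₄ e₄))) ⟨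
    s c a₁ ⊕ (s c a₂ ⊕ (s c a₃ ⊕ s c a₄)) ∎
    where
    open ≡-Reasoning
    s-part : ∀ {a} q k → a ≡ outnumberOf c q k → s c a ≡ classValue k + 8 * q
    s-part q k refl = s-outnumber q k 2≤c

  module _ {p} (rest : Vec ℕ p) where

    old new : Vec ℕ (4 + p)
    old = a₁ ∷ a₂ ∷ a₃ ∷ a₄ ∷ rest
    new = x ∷ x ∷ y ∷ z ∷ rest

    new-partition : ∀ {n} → IsPartition n (4 + p) old → IsPartition n (4 + p) new
    new-partition ((_ ∷ _ ∷ _ ∷ _ ∷ positive) , Σold≡n) =
      (1≤x ∷ 1≤x ∷ 1≤y ∷ 1≤z ∷ positive) ,
      trans (sum-swap₄ x x y z a₁ a₂ a₃ a₄ rest parts-sum) Σold≡n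

    new-not-exiting : ¬ Exiting c new
    new-not-exiting (_ ∷ _ ∷ y-out ∷ _) = y-not-outnumber y-out

    nimSum-s-preserved : nimSumBy (s c) new ≡ nimSumBy (s c) old
    nimSum-s-preserved = nimSumBy-swap₄ (s c) x x y z a₁ a₂ a₃ a₄ rest
      (trans (⊕-cancelˡ (s c x) (s c y ⊕ s c z)) s-preserved)

lemma2 : (c : ℕ) → 2 ≤ c → (p : ℕ) → 4 ≤ p → (n : ℕ) → 1 ≤ n →
    ((m : ℕ) → 1 ≤ m → m ≤ n → G (1 ∷ 2 * c ∷ []) m ≡ s c m) →
    (O : Vec ℕ p) → IsPartition n p O → Exiting c O →
    Σ (Vec ℕ p) (λ O' → IsPartition n p O' × ¬ Exiting c O' ×
    nimValue (1 ∷ 2 * c ∷ []) O' ≡ nimValue (1 ∷ 2 * c ∷ []) O)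
lemma2 (suc (suc d)) (s≤s (s≤s z≤n)) (suc (suc (suc (suc _)))) (s≤s (s≤s (s≤s (s≤s z≤n)))) n _ G≡s
  (a₁ ∷ a₂ ∷ a₃ ∷ a₄ ∷ rest) O-partition (o₁ ∷ o₂ ∷ o₃ ∷ o₄ ∷ _)
  with outnumber-residue (suc d) o₁ | outnumber-residue (suc d) o₂
     | outnumber-residue (suc d) o₃ | outnumber-residue (suc d) o₄
... | q₁ , k₁ , e₁ | q₂ , k₂ , e₂ | q₃ , k₃ , e₃ | q₄ , k₄ , e₄ =
  new rest , new-partition rest O-partition , new-not-exiting rest , (begin
    nimSumBy (G C) (new rest)
      ≡⟨ nimSumBy-cong {G C} {s c} (agree-on-parts G≡s (new-partition rest O-partition)) ⟩
    nimSumBy (s c) (new rest)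
      ≡⟨ nimSum-s-preserved rest ⟩
    nimSumBy (s c) (old rest)
      ≡⟨ nimSumBy-cong {G C} {s c} (agree-on-parts G≡s O-partition) ⟨
    nimSumBy (G C) (old rest) ∎)
  where
  open Rearranged d q₁ q₂ q₃ q₄ k₁ k₂ k₃ k₄ e₁ e₂ e₃ e₄
  open ≡-Reasoning
  C : List ℕ
  C = 1 ∷ 2 * c ∷ []
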